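{- Let $P$ be a finite graded poset, endowed with the height function $\operatorname{rk}$. Then the polynomial $\mathsf{Z}_{P,\operatorname{rk}}$ is entirely determined by the flag $f$-vector of $P$; that is, if two finite graded posets have the same flag $f$-vector, their $q$-Zeta polynomials with respect to $\operatorname{rk}$ coincide.
   Context: Let $q$ be an indeterminate and $[n]_q=(q^n-1)/(q-1)$. A poset is graded if it admits a function increasing by exactly $1$ along every cover relation; $\operatorname{rk}$ is then the such function taking minimal value $0$ on each connected component. The flag $f$-vector of a graded poset $P$ is the function assigning to each strictly increasing finite sequence $a$ of non-negative integers the number of strict chains $c_1<\cdots<c_k$ in $P$ with $(\operatorname{rk}(c_1),\ldots,\operatorname{rk}(c_k))=a$. For a finite poset $P$ with height function $h$ ($h(x)<h(y)$ whenever $y$ covers $x$), the $q$-Zeta polynomial $\mathsf{Z}_{P,h}(x)\in\mathbb{Q}(q)[x]$ is the unique polynomial such that for every integer $n\ge2$, $\mathsf{Z}_{P,h}([n]_q)=\sum_{e_1\le\cdots\le e_{n-1}}q^{h(e_1)+\cdots+h(e_{n-1})}$, summed over all weakly increasing sequences of $n-1$ elements of $P$. -}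

module Defs where

open import Data.Nat as ℕ using (ℕ; zero; suc; _+_; _∸_)
import Data.Nat.Properties as ℕP
open import Data.Fin using (Fin; _≟_)
open import Data.List using (List; []; _∷_; map)
open import Data.Nat.ListAction using (sum)
open import Data.List.Relation.Unary.Linked using (Linked)
open import Data.Maybe using (Maybe; just; nothing)
open import Data.Product using (_×_; _,_; Σ; ∃)
open import Data.Bool using (Bool; true; false; if_then_else_)
open import Data.Unit using (⊤; tt)
open import Relation.Binary.PropositionalEquality using (_≡_; _≢_)
open import Relation.Binary.Structures using (IsPartialOrder)
open import Relation.Binary.Definitions using (Decidable)
open import Relation.Nullary using (¬_; Dec; yes; no; does)
open import Relation.Nullary.Decidable using (_×-dec_; ¬?)
open import Data.Fin.Base using () renaming (Fin to F)
import Data.List.Base as L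

record FinPoset : Set₁ where
  field
    size : ℕ
    _≤_ : Fin size → Fin size → Set
    isPartialOrder : IsPartialOrder _≡_ _≤_
    _≤?_ : Decidable _≤_

  _<_ : Fin size → Fin size → Set
  x < y = (x ≤ y) × (x ≢ y)

  _<?_ : Decidable _<_
  x <? y = (x ≤? y) ×-dec ¬? (x ≟ y)

  _⋖_ : Fin size → Fin size → Set
  x ⋖ y = (x < y) × (¬ (Σ (Fin size) λ z → (x < z) × (z < y)))

  elems : List (Fin size)
  elems = L.allFin size

open FinPoset public using (size; _≤_; _≤?_; _<_; _<?_; _⋖_; elems)

data Connected (P : FinPoset) : Fin (size P) → Fin (size P) → Set where
  conn-refl : ∀ {x} → Connected P x x
  conn-up   : ∀ {x y z} → _≤_ P x y → Connected P y z → Connected P x z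
  conn-down : ∀ {x y z} → _≤_ P y x → Connected P y z → Connected P x z

-- rk is THE rank function of a graded poset: it increases by exactly 1
-- along every cover relation, and takes minimal value 0 on each connected
-- component (values are in ℕ, so "minimal value 0" = some element of the
-- component has rank 0).  A poset is graded iff such rk exists; it is unique.
record IsRankFunction (P : FinPoset) (rk : Fin (size P) → ℕ) : Set where
  field
    cover-step : ∀ x y → _⋖_ P x y → rk y ≡ suc (rk x)
    zero-in-component : ∀ x → ∃ λ y → Connected P x y × (rk y ≡ 0)

-- Flag f-vector: number of strict chains c₁ < ⋯ < cₖ whose rank sequence
-- is the given list (auxiliary argument: c₁ must lie strictly above `prev`).
chainCountFrom : (P : FinPoset) → (Fin (size P) → ℕ) → Maybe (Fin (size P)) → List ℕ → ℕ
chainCountFrom P rk prev [] = 1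
chainCountFrom P rk prev (a ∷ as) =
  sum (map (λ x → if above prev x
                  then (if does (rk x ℕ.≟ a) then chainCountFrom P rk (just x) as else 0)
                  else 0) (elems P))
  where
  above : Maybe (Fin (size P)) → Fin (size P) → Bool
  above nothing x = true
  above (just p) x = does (_<?_ P p x)

flagF : (P : FinPoset) → (Fin (size P) → ℕ) → List ℕ → ℕ
flagF P rk a = chainCountFrom P rk nothing a

weakCountFrom : (P : FinPoset) → (Fin (size P) → ℕ) → Maybe (Fin (size P)) → ℕ → ℕ → ℕ
weakCountFrom P h prev zero s = if does (s ℕ.≟ 0) then 1 else 0
weakCountFrom P h prev (suc k) s =
  sum (map (λ x → if above prev x
                  then (if does (h x ℕ.≤? s) then weakCountFrom P h (just x) k (s ∸ h x) else 0)
                  else 0) (elems P))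
  where
  above : Maybe (Fin (size P)) → Fin (size P) → Bool
  above nothing x = true
  above (just p) x = does (_≤?_ P p x)

-- zetaCoeff P h k s = coefficient of q^s in  Σ_{e₁ ≤ ⋯ ≤ eₖ} q^{h(e₁)+⋯+h(eₖ)},
-- i.e. in  Z_{P,h}([k+1]_q).
zetaCoeff : (P : FinPoset) → (Fin (size P) → ℕ) → ℕ → ℕ → ℕ
zetaCoeff P h k s = weakCountFrom P h nothing k s

Fin' : FinPoset → Set
Fin' P = Fin (size P)

{-# OPTIONS --safe #-}
module Submission where

-- A multichain e₁ ≤ ⋯ ≤ eₙ is a strict chain c₁ < ⋯ < cⱼ (its distinct elements)
-- together with positive multiplicities, and its weight Σ rk eᵢ depends only on the
-- multiplicities and the rank sequence of the chain.  So, for any height function,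
-- each coefficient of Z([n]_q) is a sum of flag f-vector entries over a list of rank
-- sequences that does not depend on the poset; the list is found by unfolding the
-- recursion of weakCountFrom and grouping the elements of P by rank.
-- Gradedness enters only to make rk strictly monotone, so that the flag f-vector
-- vanishes on sequences that are not strictly increasing, where the hypothesis is silent.

open import Defs
open import Data.Nat using (ℕ; suc)
import Data.Nat as ℕ
open import Data.List using (List)
open import Data.List.Relation.Unary.Linked using (Linked)
open import Relation.Binary.PropositionalEquality using (_≡_)

open import Data.Nat using (zero; _+_; _∸_; s≤s⁻¹)
open import Data.Nat.Properties
  using (+-identityʳ; +-commutativeSemigroup; <-cmp; <-trans; <⇒≤; <⇒≱;
         1+n≰n; m≤n⇒m≤1+n; ≤-refl; ≤-reflexive)
open import Data.Nat.ListAction using (sum)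
open import Data.Nat.ListAction.Properties using (sum-++)
open import Data.List using ([]; _∷_; [_]; _++_; map; concatMap; downFrom; allFin)
open import Data.List.Properties using (map-++; map-∘; map-cong; map-tabulate)
open import Data.List.Relation.Unary.Linked using ([]; [-]; _∷_; linked?)
open import Data.Bool using (Bool; true; false; if_then_else_)
open import Data.Maybe using (just)
open import Data.Fin using (Fin; zero; suc)
import Data.Fin as Fin
open import Data.Fin.Properties using (any?)
open import Data.Fin.Induction using (po-wellFounded; po-noetherian)
open import Data.Product using (_,_)
open import Data.Empty using (⊥-elim)
open import Function using (_∘_; flip; id)
open import Induction.WellFounded using (Acc; acc)
open import Relation.Binary.PropositionalEquality using (refl; sym; trans; cong; cong₂; module ≡-Reasoning)
open import Relation.Binary.Definitions using (Tri; tri<; tri≈; tri>)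
open import Relation.Binary.Structures using (IsPartialOrder)
open import Relation.Nullary using (Dec; yes; no; does; ¬_)
open import Relation.Nullary.Decidable using (_×-dec_; ¬?)
open import Algebra.Properties.CommutativeSemigroup +-commutativeSemigroup using (interchange)

open ≡-Reasoning

private
  variable
    A B : Set

when : Bool → ℕ → ℕ
when b n = if b then n else 0

∑ : List A → (A → ℕ) → ℕ
∑ xs f = sum (map f xs)

∑-cong : ∀ (xs : List A) {f g : A → ℕ} → (∀ x → f x ≡ g x) → ∑ xs f ≡ ∑ xs g
∑-cong xs f≗g = cong sum (map-cong f≗g xs)

∑-zero : ∀ (xs : List A) {f : A → ℕ} → (∀ x → f x ≡ 0) → ∑ xs f ≡ 0
∑-zero []       f≗0 = refl
∑-zero (x ∷ xs) f≗0 = cong₂ _+_ (f≗0 x) (∑-zero xs f≗0)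

∑-+ : ∀ (xs : List A) (f g : A → ℕ) → ∑ xs (λ x → f x + g x) ≡ ∑ xs f + ∑ xs g
∑-+ []       f g = refl
∑-+ (x ∷ xs) f g =
  trans (cong (f x + g x +_) (∑-+ xs f g)) (interchange (f x) (g x) (∑ xs f) (∑ xs g))

∑-++ : ∀ (xs ys : List A) (f : A → ℕ) → ∑ (xs ++ ys) f ≡ ∑ xs f + ∑ ys f
∑-++ xs ys f = trans (cong sum (map-++ f xs ys)) (sum-++ (map f xs) (map f ys))

∑-if : ∀ b (xs : List A) (f : A → ℕ) → ∑ (if b then xs else []) f ≡ when b (∑ xs f)
∑-if true  xs f = refl
∑-if false xs f = refl

when-∑ : ∀ b (xs : List A) (f : A → ℕ) → when b (∑ xs f) ≡ ∑ xs (λ x → when b (f x))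
when-∑ true  xs f = refl
when-∑ false xs f = sym (∑-zero xs (λ _ → refl))

∑-map : ∀ (g : A → B) (xs : List A) (f : B → ℕ) → ∑ (map g xs) f ≡ ∑ xs (f ∘ g)
∑-map g xs f = cong sum (sym (map-∘ xs))

∑-concatMap : ∀ (g : A → List B) (xs : List A) (f : B → ℕ) →
              ∑ (concatMap g xs) f ≡ ∑ xs (λ x → ∑ (g x) f)
∑-concatMap g []       f = refl
∑-concatMap g (x ∷ xs) f =
  trans (∑-++ (g x) (concatMap g xs) f) (cong (∑ (g x) f +_) (∑-concatMap g xs f))

∑-swap : ∀ (xs : List A) (ys : List B) (f : A → B → ℕ) →
         ∑ xs (λ x → ∑ ys (f x)) ≡ ∑ ys (λ y → ∑ xs (λ x → f x y))
∑-swap []       ys f = sym (∑-zero ys (λ _ → refl))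
∑-swap (x ∷ xs) ys f = begin
  ∑ ys (f x) + ∑ xs (λ x → ∑ ys (f x))          ≡⟨ cong (∑ ys (f x) +_) (∑-swap xs ys f) ⟩
  ∑ ys (f x) + ∑ ys (λ y → ∑ xs (λ x → f x y))  ≡⟨ sym (∑-+ ys (f x) _) ⟩
  ∑ ys (λ y → f x y + ∑ xs (λ x → f x y))       ∎

when-yes : (a? : Dec A) {n : ℕ} → A → when (does a?) n ≡ n
when-yes (yes _) _ = refl
when-yes (no ¬a) a = ⊥-elim (¬a a)

when-no : (a? : Dec A) {n : ℕ} → ¬ A → when (does a?) n ≡ 0
when-no (yes a) ¬a = ⊥-elim (¬a a)
when-no (no _)  _  = refl

∑-allFin-suc : ∀ {n} (g : Fin (suc n) → ℕ) → ∑ (allFin (suc n)) g ≡ g zero + ∑ (allFin n) (g ∘ suc)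
∑-allFin-suc g =
  cong (g zero +_) (cong sum (trans (map-tabulate suc g) (sym (map-tabulate id (g ∘ suc)))))

∑-allFin-delta : ∀ {n} (p : Fin n) (f : Fin n → ℕ) →
                 ∑ (allFin n) (λ x → when (does (p Fin.≟ x)) (f x)) ≡ f p
∑-allFin-delta {suc n} zero f = begin
  ∑ (allFin (suc n)) (λ x → when (does (zero Fin.≟ x)) (f x))
    ≡⟨ ∑-allFin-suc (λ x → when (does (zero Fin.≟ x)) (f x)) ⟩
  f zero + ∑ (allFin n) (λ _ → 0)
    ≡⟨ cong (f zero +_) (∑-zero (allFin n) (λ _ → refl)) ⟩
  f zero + 0
    ≡⟨ +-identityʳ (f zero) ⟩
  f zero
    ∎
∑-allFin-delta {suc n} (suc p) f =
  trans (∑-allFin-suc (λ x → when (does (suc p Fin.≟ x)) (f x))) (∑-allFin-delta p (f ∘ suc))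

∑-downFrom-delta : ∀ s r (f : ℕ → ℕ) →
                   ∑ (downFrom (suc s)) (λ b → when (does (r ℕ.≟ b)) (f b)) ≡ when (does (r ℕ.≤? s)) (f r)
∑-downFrom-delta zero    zero    f = +-identityʳ (f 0)
∑-downFrom-delta zero    (suc r) f = refl
∑-downFrom-delta (suc s) r       f =
  trans (cong (when (does (r ℕ.≟ suc s)) (f (suc s)) +_) (∑-downFrom-delta s r f))
        (step (<-cmp r (suc s)))
  where
  step : ∀ {r} → Tri (r ℕ.< suc s) (r ≡ suc s) (suc s ℕ.< r) →
         when (does (r ℕ.≟ suc s)) (f (suc s)) + when (does (r ℕ.≤? s)) (f r)
           ≡ when (does (r ℕ.≤? suc s)) (f r)
  step {r} (tri< r<1+s r≢1+s _) =
    trans (cong₂ _+_ (when-no (r ℕ.≟ suc s) r≢1+s) (when-yes (r ℕ.≤? s) (s≤s⁻¹ r<1+s)))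
          (sym (when-yes (r ℕ.≤? suc s) (<⇒≤ r<1+s)))
  step (tri≈ _ refl _) =
    trans (cong₂ _+_ (when-yes (suc s ℕ.≟ suc s) refl) (when-no (suc s ℕ.≤? s) 1+n≰n))
          (trans (+-identityʳ (f (suc s))) (sym (when-yes (suc s ℕ.≤? suc s) ≤-refl)))
  step {r} (tri> _ r≢1+s 1+s<r) =
    trans (cong₂ _+_ (when-no (r ℕ.≟ suc s) r≢1+s) (when-no (r ℕ.≤? s) (<⇒≱ 1+s<r ∘ m≤n⇒m≤1+n)))
          (sym (when-no (r ℕ.≤? suc s) (<⇒≱ 1+s<r)))

-- profiles r k s lists, with multiplicity, the rank sequences of the new elements met
-- when a multichain whose last element has rank r is extended by k elements of total
-- rank s; profiles⁺ k s covers the extensions by k + 1 elements whose first one is new.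
mutual
  profiles : ℕ → ℕ → ℕ → List (List ℕ)
  profiles r zero    s = if does (s ℕ.≟ 0) then [ [] ] else []
  profiles r (suc k) s = (if does (r ℕ.≤? s) then profiles r k (s ∸ r) else []) ++ profiles⁺ k s

  profiles⁺ : ℕ → ℕ → List (List ℕ)
  profiles⁺ k s = concatMap (λ b → map (b ∷_) (profiles b k (s ∸ b))) (downFrom (suc s))

∑-profiles⁺ : ∀ k s (f : List ℕ → ℕ) →
              ∑ (profiles⁺ k s) f ≡ ∑ (downFrom (suc s)) (λ b → ∑ (profiles b k (s ∸ b)) (λ w → f (b ∷ w)))
∑-profiles⁺ k s f = trans (∑-concatMap (λ b → map (b ∷_) (profiles b k (s ∸ b))) (downFrom (suc s)) f)
                          (∑-cong (downFrom (suc s)) (λ b → ∑-map (b ∷_) (profiles b k (s ∸ b)) f))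

module Counting (P : FinPoset) (h : Fin' P → ℕ) where

  open FinPoset P using (isPartialOrder)
    renaming (_≤_ to _⊑_; _≤?_ to _⊑?_; _<?_ to _⊏?_)

  private
    El : List (Fin' P)
    El = elems P

  C : Fin' P → List ℕ → ℕ
  C p = chainCountFrom P h (just p)

  -- C p (b ∷ w) and flagF P h (b ∷ w) unfold to firstStep ok b w, with ok x = does (p ⊏? x)
  -- and ok x = true respectively.
  firstStep : (Fin' P → Bool) → ℕ → List ℕ → ℕ
  firstStep ok b w = ∑ El (λ x → when (ok x) (when (does (h x ℕ.≟ b)) (C x w)))

  regroupByRank : ∀ (ok : Fin' P → Bool) k s →
      ∑ El (λ x → when (ok x) (when (does (h x ℕ.≤? s)) (∑ (profiles (h x) k (s ∸ h x)) (C x))))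
    ≡ ∑ (downFrom (suc s)) (λ b → ∑ (profiles b k (s ∸ b)) (firstStep ok b))
  regroupByRank ok k s = begin
      ∑ El (λ x → when (ok x) (when (does (h x ℕ.≤? s)) (G x (h x))))
    ≡⟨ ∑-cong El (λ x → cong (when (ok x)) (sym (∑-downFrom-delta s (h x) (G x)))) ⟩
      ∑ El (λ x → when (ok x) (∑ Bs (λ b → when (does (h x ℕ.≟ b)) (G x b))))
    ≡⟨ ∑-cong El (λ x → when-∑ (ok x) Bs _) ⟩
      ∑ El (λ x → ∑ Bs (λ b → when (ok x) (when (does (h x ℕ.≟ b)) (G x b))))
    ≡⟨ ∑-swap El Bs _ ⟩
      ∑ Bs (λ b → ∑ El (λ x → when (ok x) (when (does (h x ℕ.≟ b)) (G x b))))
    ≡⟨ ∑-cong Bs (λ b → ∑-cong El (λ x →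
         when²-∑ (ok x) (does (h x ℕ.≟ b)) (profiles b k (s ∸ b)) (C x))) ⟩
      ∑ Bs (λ b → ∑ El (λ x → ∑ (profiles b k (s ∸ b))
                                 (λ w → when (ok x) (when (does (h x ℕ.≟ b)) (C x w)))))
    ≡⟨ ∑-cong Bs (λ b → ∑-swap El (profiles b k (s ∸ b)) _) ⟩
      ∑ Bs (λ b → ∑ (profiles b k (s ∸ b)) (firstStep ok b))
    ∎
    where
    Bs : List ℕ
    Bs = downFrom (suc s)
    G : Fin' P → ℕ → ℕ
    G x b = ∑ (profiles b k (s ∸ b)) (C x)
    when²-∑ : ∀ b c (xs : List (List ℕ)) (f : List ℕ → ℕ) →
              when b (when c (∑ xs f)) ≡ ∑ xs (λ w → when b (when c (f w)))
    when²-∑ b c xs f = trans (cong (when b) (when-∑ c xs f)) (when-∑ b xs _)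

  when-⊑-split : ∀ {p x} (p≡x? : Dec (p ≡ x)) (p⊑x? : Dec (p ⊑ x)) n →
                 when (does p⊑x?) n ≡ when (does p≡x?) n + when (does (p⊑x? ×-dec ¬? p≡x?)) n
  when-⊑-split (yes refl) (yes _)   n = sym (+-identityʳ n)
  when-⊑-split (yes refl) (no p⋢p)  n = ⊥-elim (p⋢p (IsPartialOrder.refl isPartialOrder))
  when-⊑-split (no _)     (yes _)   n = refl
  when-⊑-split (no _)     (no _)    n = refl

  ∑-⊑-split : ∀ p (f : Fin' P → ℕ) →
              ∑ El (λ x → when (does (p ⊑? x)) (f x)) ≡ f p + ∑ El (λ x → when (does (p ⊏? x)) (f x))
  ∑-⊑-split p f = begin
      ∑ El (λ x → when (does (p ⊑? x)) (f x))
    ≡⟨ ∑-cong El (λ x → when-⊑-split (p Fin.≟ x) (p ⊑? x) (f x)) ⟩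
      ∑ El (λ x → when (does (p Fin.≟ x)) (f x) + when (does (p ⊏? x)) (f x))
    ≡⟨ ∑-+ El _ _ ⟩
      ∑ El (λ x → when (does (p Fin.≟ x)) (f x)) + ∑ El (λ x → when (does (p ⊏? x)) (f x))
    ≡⟨ cong (_+ ∑ El (λ x → when (does (p ⊏? x)) (f x))) (∑-allFin-delta p f) ⟩
      f p + ∑ El (λ x → when (does (p ⊏? x)) (f x))
    ∎

  weakCount≡∑profiles : ∀ k s p → weakCountFrom P h (just p) k s ≡ ∑ (profiles (h p) k s) (C p)
  weakCount≡∑profiles zero s p with does (s ℕ.≟ 0)
  ... | true  = refl
  ... | false = refl
  weakCount≡∑profiles (suc k) s p = begin
      weakCountFrom P h (just p) (suc k) s
    ≡⟨ ∑-cong El (λ x → cong (when (does (p ⊑? x)) ∘ when (does (h x ℕ.≤? s)))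
                             (weakCount≡∑profiles k (s ∸ h x) x)) ⟩
      ∑ El (λ x → when (does (p ⊑? x)) (F x))
    ≡⟨ ∑-⊑-split p F ⟩
      F p + ∑ El (λ x → when (does (p ⊏? x)) (F x))
    ≡⟨ cong₂ _+_ (sym (∑-if (does (h p ℕ.≤? s)) (profiles (h p) k (s ∸ h p)) (C p)))
                 (trans (regroupByRank (λ x → does (p ⊏? x)) k s) (sym (∑-profiles⁺ k s (C p)))) ⟩
      ∑ (if does (h p ℕ.≤? s) then profiles (h p) k (s ∸ h p) else []) (C p) + ∑ (profiles⁺ k s) (C p)
    ≡⟨ sym (∑-++ (if does (h p ℕ.≤? s) then profiles (h p) k (s ∸ h p) else []) _ (C p)) ⟩
      ∑ (profiles (h p) (suc k) s) (C p)
    ∎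
    where
    F : Fin' P → ℕ
    F x = when (does (h x ℕ.≤? s)) (∑ (profiles (h x) k (s ∸ h x)) (C x))

  zetaCoeff≡∑profiles⁺ : ∀ k s → zetaCoeff P h (suc k) s ≡ ∑ (profiles⁺ k s) (flagF P h)
  zetaCoeff≡∑profiles⁺ k s = begin
      zetaCoeff P h (suc k) s
    ≡⟨ ∑-cong El (λ x → cong (when (does (h x ℕ.≤? s))) (weakCount≡∑profiles k (s ∸ h x) x)) ⟩
      ∑ El (λ x → when true (when (does (h x ℕ.≤? s)) (∑ (profiles (h x) k (s ∸ h x)) (C x))))
    ≡⟨ regroupByRank (λ _ → true) k s ⟩
      ∑ (downFrom (suc s)) (λ b → ∑ (profiles b k (s ∸ b)) (firstStep (λ _ → true) b))
    ≡⟨ sym (∑-profiles⁺ k s (flagF P h)) ⟩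
      ∑ (profiles⁺ k s) (flagF P h)
    ∎

module StrictlyMonotone (P : FinPoset) (h : Fin' P → ℕ) (cover-< : ∀ x y → _⋖_ P x y → h x ℕ.< h y) where

  open FinPoset P using (isPartialOrder)
    renaming (_<_ to _⊏_; _<?_ to _⊏?_)

  ⊏⇒< : ∀ {x y} → x ⊏ y → h x ℕ.< h y
  ⊏⇒< {x} {y} = go (po-wellFounded isPartialOrder y) (po-noetherian isPartialOrder x)
    where
    -- Outer induction on y, inner (upwards) on x: an element z strictly between x and y
    -- gives h x < h z by the outer hypothesis and h z < h y by the inner one.
    go : ∀ {x y} → Acc _⊏_ y → Acc (flip _⊏_) x → x ⊏ y → h x ℕ.< h y
    go {x} {y} accʸ@(acc below-y) accˣ@(acc above-x) x⊏y with any? (λ z → (x ⊏? z) ×-dec (z ⊏? y))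
    ... | yes (z , x⊏z , z⊏y) = <-trans (go (below-y z⊏y) accˣ x⊏z) (go accʸ (above-x x⊏z) z⊏y)
    ... | no nothing-between  = cover-< x y (x⊏y , nothing-between)

  chainCount-vanishes : ∀ p w → ¬ Linked ℕ._<_ (h p ∷ w) → chainCountFrom P h (just p) w ≡ 0
  chainCount-vanishes p []      ¬↗ = ⊥-elim (¬↗ [-])
  chainCount-vanishes p (b ∷ w) ¬↗ = ∑-zero (elems P) (λ x → term x (p ⊏? x) (h x ℕ.≟ b))
    where
    term : ∀ x (p⊏x? : Dec (p ⊏ x)) (hx≡b? : Dec (h x ≡ b)) →
           when (does p⊏x?) (when (does hx≡b?) (chainCountFrom P h (just x) w)) ≡ 0
    term x (yes p⊏x) (yes refl) = chainCount-vanishes x w (λ ↗ → ¬↗ (⊏⇒< p⊏x ∷ ↗))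
    term x (yes _)   (no _)     = refl
    term x (no _)    _          = refl

  flagF-vanishes : ∀ a → ¬ Linked ℕ._<_ a → flagF P h a ≡ 0
  flagF-vanishes []      ¬↗ = ⊥-elim (¬↗ [])
  flagF-vanishes (b ∷ w) ¬↗ = ∑-zero (elems P) (λ x → term x (h x ℕ.≟ b))
    where
    term : ∀ x (hx≡b? : Dec (h x ≡ b)) → when (does hx≡b?) (chainCountFrom P h (just x) w) ≡ 0
    term x (yes refl) = chainCount-vanishes x w ¬↗
    term x (no _)     = refl

rank-cover-< : ∀ {P rk} → IsRankFunction P rk → ∀ x y → _⋖_ P x y → rk x ℕ.< rk y
rank-cover-< isRank x y x⋖y = ≤-reflexive (sym (IsRankFunction.cover-step isRank x y x⋖y))

mainTheorem16 : (P Q : FinPoset)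
    → (rkP : Fin' P → ℕ) → (rkQ : Fin' Q → ℕ)
    → IsRankFunction P rkP → IsRankFunction Q rkQ
    → (∀ (a : List ℕ) → Linked ℕ._<_ a → flagF P rkP a ≡ flagF Q rkQ a)
    → ∀ (k s : ℕ) → zetaCoeff P rkP (suc k) s ≡ zetaCoeff Q rkQ (suc k) s
mainTheorem16 P Q rkP rkQ isRankP isRankQ sameFlags k s = begin
    zetaCoeff P rkP (suc k) s        ≡⟨ Counting.zetaCoeff≡∑profiles⁺ P rkP k s ⟩
    ∑ (profiles⁺ k s) (flagF P rkP)  ≡⟨ ∑-cong (profiles⁺ k s) sameFlags′ ⟩
    ∑ (profiles⁺ k s) (flagF Q rkQ)  ≡⟨ sym (Counting.zetaCoeff≡∑profiles⁺ Q rkQ k s) ⟩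
    zetaCoeff Q rkQ (suc k) s        ∎
  where
  sameFlags′ : ∀ a → flagF P rkP a ≡ flagF Q rkQ a
  sameFlags′ a with linked? ℕ._<?_ a
  ... | yes ↗ = sameFlags a ↗
  ... | no ¬↗ = trans (StrictlyMonotone.flagF-vanishes P rkP (rank-cover-< isRankP) a ¬↗)
                      (sym (StrictlyMonotone.flagF-vanishes Q rkQ (rank-cover-< isRankQ) a ¬↗))
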